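{- For non-negative integers $a,b,c,d$, $$\sum_{k=0}^a k\binom{a+b}{a+k}\binom{b+c}{b+k}\binom{c+d}{c+k}\binom{d+a}{d+k}=\frac{b\,Q_{b,c}Q_{c,d}Q_{b+c+d,a}}{2\,Q_{a,c}}\sum_{j=0}^{a-1}\frac{Q_{b,j}\,Q_{c-1,j+1}\,Q_{d-1,j+1}}{Q_{b+c+d,j+1}}.$$
   Context: For integers $x,y$, $Q_{x,y}:=\binom{x+y}{x}$. Convention: an empty sum equals $0$, and $\binom{N}{k}=0$ whenever $k<0$ or $k>N$ (so e.g. $Q_{ -1,y}=\binom{y-1}{ -1}=0$). -}

module Defs where

open import Data.Nat using (ℕ; zero; suc; _+_; _*_)
open import Data.Nat.Combinatorics using (_C_)
open import Data.Integer using (ℤ; +_; -[1+_])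
open import Data.Rational using (ℚ; 0ℚ; _/_)
import Data.Rational as ℚ
open import Data.List using (List; map; upTo)

Q : ℕ → ℕ → ℕ
Q x y = (x + y) C x

-- Q_{x,y} for integer x and natural y, with the convention binom(N,k) = 0 for k < 0:
-- if x < 0 then the lower index x is negative, so Q_{x,y} = 0.
Qℤ : ℤ → ℕ → ℕ
Qℤ (+ x)    y = Q x y
Qℤ -[1+ x ] y = 0

⟦_⟧ : ℕ → ℚ
⟦ n ⟧ = + n / 1

-- m / n as a rational; only used with n > 0 (value 0 for n = 0 is never used)
frac : ℕ → ℕ → ℚ
frac m zero    = 0ℚ
frac m (suc n) = + m / suc n

sumℕ : ℕ → (ℕ → ℕ) → ℕ
sumℕ zero  f = 0
sumℕ (suc n) f = sumℕ n f + f n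

sumℚ : ℕ → (ℕ → ℚ) → ℚ
sumℚ zero  f = 0ℚ
sumℚ (suc n) f = sumℚ n f ℚ.+ f n

module Submission where

-- Let F(a,k) be the k-th summand on the left and S(a) = Σ_{k≤a} F(a,k). Zeilberger's algorithm gives
-- a certificate G(a,k) with
--   p₁ F(a+1,k) + G(a,k+1) = p₀ F(a,k) + G(a,k),   p₁ = 2(a+d+1)(a+c+1),   p₀ = 2(a+d+1)(a+b+c+d+1);
-- once every binomial is written as a rational multiple of its neighbour this is a polynomial identity.
-- Summing over k telescopes to p₁ S(a+1) = p₀ S(a) + G(a,0). The right-hand side, a prefactor P(a)
-- times a sum T(a) = Σ_{j<a} t(j), obeys the same recurrence because P(a+1)/P(a) = p₀/p₁ and
-- p₁ P(a+1) t(a) = G(a,0); both sides vanish at a = 0.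

open import Defs
open import Data.Nat
open import Data.Nat.Properties
open import Data.Nat.Combinatorics using (_C_; nCk+nC[k+1]≡[n+1]C[k+1]; k>n⇒nCk≡0; nC1≡n; nCk≡nC[n∸k])
open import Data.Nat.Tactic.RingSolver using (solve-∀)
open import Data.Integer using (+_; _-_)
import Data.Integer as ℤ
import Data.Integer.Properties as ℤ
open import Data.Rational using (ℚ; fromℚᵘ)
import Data.Rational as ℚ
import Data.Rational.Properties as ℚ
open import Data.Rational.Unnormalised using (mkℚᵘ; *≡*)
import Data.Rational.Unnormalised as ℚᵘ
import Data.Rational.Unnormalised.Properties as ℚᵘ
open import Data.Rational.Solver using (module +-*-Solver)
open import Data.Product using (_,_)
open import Data.Sum using (_⊎_; inj₁; inj₂)
import Data.Sum as Sum
open import Relation.Binary.PropositionalEquality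
open import Relation.Nullary using (yes; no)
open import Algebra.Properties.CommutativeSemigroup +-commutativeSemigroup using (x∙yz≈xz∙y; xy∙z≈xz∙y)
open ≡-Reasoning

[k+1]*[n+1]C[k+1]≡[n+1]*nCk : ∀ n k → suc k * (suc n C suc k) ≡ suc n * (n C k)
[k+1]*[n+1]C[k+1]≡[n+1]*nCk zero    zero    = refl
[k+1]*[n+1]C[k+1]≡[n+1]*nCk zero    (suc k) = *-zeroʳ (2 + k)
[k+1]*[n+1]C[k+1]≡[n+1]*nCk (suc n) zero    = trans (+-identityʳ _) (trans (nC1≡n (2 + n)) (sym (*-identityʳ (2 + n))))
[k+1]*[n+1]C[k+1]≡[n+1]*nCk (suc n) (suc k) = begin
  suc (suc k) * (suc (suc n) C suc (suc k))
    ≡⟨ cong (suc (suc k) *_) (nCk+nC[k+1]≡[n+1]C[k+1] (suc n) (suc k)) ⟨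
  suc (suc k) * (x + y)
    ≡⟨ distribute k x y ⟩
  x + (suc k * x + suc (suc k) * y)
    ≡⟨ cong (_+_ x) (cong₂ _+_ ([k+1]*[n+1]C[k+1]≡[n+1]*nCk n k) ([k+1]*[n+1]C[k+1]≡[n+1]*nCk n (suc k))) ⟩
  x + (suc n * (n C k) + suc n * (n C suc k))
    ≡⟨ cong (_+_ x) (*-distribˡ-+ (suc n) (n C k) (n C suc k)) ⟨
  x + suc n * (n C k + n C suc k)
    ≡⟨ cong (λ z → x + suc n * z) (nCk+nC[k+1]≡[n+1]C[k+1] n k) ⟩
  suc (suc n) * x ∎
  where
  x = suc n C suc k
  y = suc n C suc (suc k)
  distribute : ∀ k x y → suc (suc k) * (x + y) ≡ x + (suc k * x + suc (suc k) * y)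
  distribute = solve-∀

[k+1]*[k+r]C[k+1]≡r*[k+r]Ck : ∀ k r → suc k * ((k + r) C suc k) ≡ r * ((k + r) C k)
[k+1]*[k+r]C[k+1]≡r*[k+r]Ck k r = +-cancelˡ-≡ (suc k * x) _ _ (begin
  suc k * x + suc k * y   ≡⟨ *-distribˡ-+ (suc k) x y ⟨
  suc k * (x + y)         ≡⟨ cong (suc k *_) (nCk+nC[k+1]≡[n+1]C[k+1] (k + r) k) ⟩
  suc k * (suc (k + r) C suc k) ≡⟨ [k+1]*[n+1]C[k+1]≡[n+1]*nCk (k + r) k ⟩
  suc (k + r) * x         ≡⟨ *-distribʳ-+ x (suc k) r ⟩
  suc k * x + r * x       ∎)
  where
  x = (k + r) C k
  y = (k + r) C suc k

[m+n]Cm≡[m+n]Cn : ∀ m n → (m + n) C m ≡ (m + n) C n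
[m+n]Cm≡[m+n]Cn m n = trans (nCk≡nC[n∸k] (m≤m+n m n)) (cong ((m + n) C_) (m+n∸m≡n m n))

[r+1]*[k+r+1]Ck≡[k+r+1]*[k+r]Ck : ∀ k r → suc r * (suc (k + r) C k) ≡ suc (k + r) * ((k + r) C k)
[r+1]*[k+r+1]Ck≡[k+r+1]*[k+r]Ck k r = begin
  suc r * (suc (k + r) C k)        ≡⟨ cong (λ n → suc r * (n C k)) (+-suc k r) ⟨
  suc r * ((k + suc r) C k)        ≡⟨ cong (suc r *_) ([m+n]Cm≡[m+n]Cn k (suc r)) ⟩
  suc r * ((k + suc r) C suc r)    ≡⟨ cong (λ n → suc r * (n C suc r)) (+-suc k r) ⟩
  suc r * (suc (k + r) C suc r)    ≡⟨ [k+1]*[n+1]C[k+1]≡[n+1]*nCk (k + r) r ⟩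
  suc (k + r) * ((k + r) C r)      ≡⟨ cong (suc (k + r) *_) ([m+n]Cm≡[m+n]Cn k r) ⟨
  suc (k + r) * ((k + r) C k)      ∎

0<[m+n]Cm : ∀ m n → 0 < (m + n) C m
0<[m+n]Cm zero    n = z<s
0<[m+n]Cm (suc m) n = <-≤-trans (0<[m+n]Cm m n)
  (subst ((m + n) C m ≤_) (nCk+nC[k+1]≡[n+1]C[k+1] (m + n) m) (m≤m+n _ _))

Q-comm : ∀ x y → Q x y ≡ Q y x
Q-comm x y = trans ([m+n]Cm≡[m+n]Cn x y) (cong (_C y) (+-comm x y))

[x+1]*Q[x+1]y≡[x+y+1]*Qxy : ∀ x y → suc x * Q (suc x) y ≡ suc (x + y) * Q x y
[x+1]*Q[x+1]y≡[x+y+1]*Qxy x y = [k+1]*[n+1]C[k+1]≡[n+1]*nCk (x + y) x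

[y+1]*Qx[y+1]≡[x+y+1]*Qxy : ∀ x y → suc y * Q x (suc y) ≡ suc (x + y) * Q x y
[y+1]*Qx[y+1]≡[x+y+1]*Qxy x y = begin
  suc y * Q x (suc y)    ≡⟨ cong (suc y *_) (Q-comm x (suc y)) ⟩
  suc y * Q (suc y) x    ≡⟨ [x+1]*Q[x+1]y≡[x+y+1]*Qxy y x ⟩
  suc (y + x) * Q y x    ≡⟨ cong₂ (λ n q → suc n * q) (+-comm y x) (Q-comm y x) ⟩
  suc (x + y) * Q x y    ∎

[y+x+1]*Q[x-1][y+1]≡x*Qx[y+1] : ∀ x y → suc (y + x) * Qℤ (+ x - + 1) (suc y) ≡ x * Q x (suc y)
[y+x+1]*Q[x-1][y+1]≡x*Qx[y+1] zero     y = *-zeroʳ (suc (y + 0))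
[y+x+1]*Q[x-1][y+1]≡x*Qx[y+1] (suc x) y = begin
  suc (y + suc x) * Q x (suc y)
    ≡⟨ cong (λ n → suc n * Q x (suc y)) (trans (+-suc y x) (trans (cong suc (+-comm y x)) (sym (+-suc x y)))) ⟩
  suc (x + suc y) * Q x (suc y)    ≡⟨ [x+1]*Q[x+1]y≡[x+y+1]*Qxy x (suc y) ⟨
  suc x * Q (suc x) (suc y)        ∎

Q-nonZero : ∀ x y → NonZero (Q x y)
Q-nonZero x y = >-nonZero (0<[m+n]Cm x y)

2*Q-nonZero : ∀ x y → NonZero (2 * Q x y)
2*Q-nonZero x y = m*n≢0 2 (Q x y) {{_}} {{Q-nonZero x y}}

sumℕ-telescope : ∀ n (f g h : ℕ → ℕ) → (∀ k → k < n → f k + h (suc k) ≡ g k + h k) → sumℕ n f + h n ≡ sumℕ n g + h 0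
sumℕ-telescope zero    f g h step = refl
sumℕ-telescope (suc n) f g h step = begin
  sumℕ n f + f n + h (suc n)   ≡⟨ +-assoc (sumℕ n f) (f n) (h (suc n)) ⟩
  sumℕ n f + (f n + h (suc n)) ≡⟨ cong (_+_ (sumℕ n f)) (step n (n<1+n n)) ⟩
  sumℕ n f + (g n + h n)       ≡⟨ x∙yz≈xz∙y (sumℕ n f) (g n) (h n) ⟩
  sumℕ n f + h n + g n         ≡⟨ cong (_+ g n) (sumℕ-telescope n f g h (λ k k<n → step k (m<n⇒m<1+n k<n))) ⟩
  sumℕ n g + h 0 + g n         ≡⟨ xy∙z≈xz∙y (sumℕ n g) (h 0) (g n) ⟩
  sumℕ n g + g n + h 0         ∎

*-distribˡ-sumℕ : ∀ m n (f : ℕ → ℕ) → m * sumℕ n f ≡ sumℕ n (λ k → m * f k)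
*-distribˡ-sumℕ m zero    f = *-zeroʳ m
*-distribˡ-sumℕ m (suc n) f = trans (*-distribˡ-+ m (sumℕ n f) (f n)) (cong (_+ m * f n) (*-distribˡ-sumℕ m n f))

fromℚᵘ-homo-* : ∀ p q → fromℚᵘ (p ℚᵘ.* q) ≡ fromℚᵘ p ℚ.* fromℚᵘ q
fromℚᵘ-homo-* p q = ℚ.toℚᵘ-injective (ℚᵘ.≃-trans (ℚ.toℚᵘ-fromℚᵘ (p ℚᵘ.* q))
  (ℚᵘ.≃-sym (ℚᵘ.≃-trans (ℚ.toℚᵘ-homo-* (fromℚᵘ p) (fromℚᵘ q)) (ℚᵘ.*-cong (ℚ.toℚᵘ-fromℚᵘ p) (ℚ.toℚᵘ-fromℚᵘ q)))))

fromℚᵘ-homo-+ : ∀ p q → fromℚᵘ (p ℚᵘ.+ q) ≡ fromℚᵘ p ℚ.+ fromℚᵘ q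
fromℚᵘ-homo-+ p q = ℚ.toℚᵘ-injective (ℚᵘ.≃-trans (ℚ.toℚᵘ-fromℚᵘ (p ℚᵘ.+ q))
  (ℚᵘ.≃-sym (ℚᵘ.≃-trans (ℚ.toℚᵘ-homo-+ (fromℚᵘ p) (fromℚᵘ q)) (ℚᵘ.+-cong (ℚ.toℚᵘ-fromℚᵘ p) (ℚ.toℚᵘ-fromℚᵘ q)))))

⟦⟧-homo-* : ∀ m n → ⟦ m * n ⟧ ≡ ⟦ m ⟧ ℚ.* ⟦ n ⟧
⟦⟧-homo-* m n = trans (cong (λ i → fromℚᵘ (mkℚᵘ i 0)) (ℤ.pos-* m n)) (fromℚᵘ-homo-* (mkℚᵘ (+ m) 0) (mkℚᵘ (+ n) 0))

⟦⟧-homo-+ : ∀ m n → ⟦ m + n ⟧ ≡ ⟦ m ⟧ ℚ.+ ⟦ n ⟧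
⟦⟧-homo-+ m n =
  trans (cong (λ i → fromℚᵘ (mkℚᵘ i 0)) (trans (ℤ.pos-+ m n) (sym (cong₂ ℤ._+_ (ℤ.*-identityʳ (+ m)) (ℤ.*-identityʳ (+ n))))))
  (fromℚᵘ-homo-+ (mkℚᵘ (+ m) 0) (mkℚᵘ (+ n) 0))

frac-* : ∀ m n p q .{{_ : NonZero n}} .{{_ : NonZero q}} → frac m n ℚ.* frac p q ≡ frac (m * p) (n * q)
frac-* m (suc n) p (suc q) =
  sym (trans (cong (λ i → fromℚᵘ (mkℚᵘ i _)) (ℤ.pos-* m p)) (fromℚᵘ-homo-* (mkℚᵘ (+ m) n) (mkℚᵘ (+ p) q)))

frac-cross : ∀ m n m′ n′ .{{_ : NonZero n}} .{{_ : NonZero n′}} → m * n′ ≡ m′ * n → frac m n ≡ frac m′ n′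
frac-cross m (suc n) m′ (suc n′) eq = ℚ.fromℚᵘ-cong {mkℚᵘ (+ m) n} {mkℚᵘ (+ m′) n′}
  (*≡* (trans (sym (ℤ.pos-* m (suc n′))) (trans (cong +_ eq) (ℤ.pos-* m′ (suc n)))))

⟦⟧*frac : ∀ k m n .{{_ : NonZero n}} → ⟦ k ⟧ ℚ.* frac m n ≡ frac (k * m) n
⟦⟧*frac k m n =
  trans (frac-* k 1 m n) (frac-cross (k * m) (1 * n) (k * m) n {{m*n≢0 1 n}} (cong (k * m *_) (sym (*-identityˡ n))))

frac-1-inverseˡ : ∀ n .{{_ : NonZero n}} → frac 1 n ℚ.* ⟦ n ⟧ ≡ ℚ.1ℚ
frac-1-inverseˡ n = trans (frac-* 1 n n 1) (frac-cross (1 * n) (n * 1) 1 1 {{m*n≢0 n 1}} (*-assoc 1 n 1))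

⟦⟧*-cancelˡ : ∀ n .{{_ : NonZero n}} {x y} → ⟦ n ⟧ ℚ.* x ≡ ⟦ n ⟧ ℚ.* y → x ≡ y
⟦⟧*-cancelˡ n {x} {y} eq = begin
  x                             ≡⟨ ℚ.*-identityˡ x ⟨
  ℚ.1ℚ ℚ.* x                    ≡⟨ cong (ℚ._* x) (frac-1-inverseˡ n) ⟨
  frac 1 n ℚ.* ⟦ n ⟧ ℚ.* x      ≡⟨ ℚ.*-assoc (frac 1 n) ⟦ n ⟧ x ⟩
  frac 1 n ℚ.* (⟦ n ⟧ ℚ.* x)    ≡⟨ cong (frac 1 n ℚ.*_) eq ⟩
  frac 1 n ℚ.* (⟦ n ⟧ ℚ.* y)    ≡⟨ ℚ.*-assoc (frac 1 n) ⟦ n ⟧ y ⟨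
  frac 1 n ℚ.* ⟦ n ⟧ ℚ.* y      ≡⟨ cong (ℚ._* y) (frac-1-inverseˡ n) ⟩
  ℚ.1ℚ ℚ.* y                    ≡⟨ ℚ.*-identityˡ y ⟩
  y                             ∎

closed-form-step : ∀ {S₀ S₁ p₀ p₁ G} .{{_ : NonZero p₁}} {P₀ P₁ T t} →
  p₁ * S₁ ≡ p₀ * S₀ + G → ⟦ p₁ ⟧ ℚ.* P₁ ≡ ⟦ p₀ ⟧ ℚ.* P₀ → ⟦ p₁ ⟧ ℚ.* (P₁ ℚ.* t) ≡ ⟦ G ⟧ →
  ⟦ S₀ ⟧ ≡ P₀ ℚ.* T → ⟦ S₁ ⟧ ≡ P₁ ℚ.* (T ℚ.+ t)
closed-form-step {S₀} {S₁} {p₀} {p₁} {G} {P₀} {P₁} {T} {t} recurrence P-ratio Pt S₀≡ = ⟦⟧*-cancelˡ p₁ (begin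
  ⟦ p₁ ⟧ ℚ.* ⟦ S₁ ⟧                                ≡⟨ ⟦⟧-homo-* p₁ S₁ ⟨
  ⟦ p₁ * S₁ ⟧                                      ≡⟨ cong ⟦_⟧ recurrence ⟩
  ⟦ p₀ * S₀ + G ⟧                                  ≡⟨ trans (⟦⟧-homo-+ (p₀ * S₀) G) (cong (ℚ._+ ⟦ G ⟧) (⟦⟧-homo-* p₀ S₀)) ⟩
  ⟦ p₀ ⟧ ℚ.* ⟦ S₀ ⟧ ℚ.+ ⟦ G ⟧                      ≡⟨ cong₂ (λ x y → ⟦ p₀ ⟧ ℚ.* x ℚ.+ y) S₀≡ (sym Pt) ⟩
  ⟦ p₀ ⟧ ℚ.* (P₀ ℚ.* T) ℚ.+ ⟦ p₁ ⟧ ℚ.* (P₁ ℚ.* t)  ≡⟨ cong (ℚ._+ ⟦ p₁ ⟧ ℚ.* (P₁ ℚ.* t)) (ℚ.*-assoc ⟦ p₀ ⟧ P₀ T) ⟨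
  ⟦ p₀ ⟧ ℚ.* P₀ ℚ.* T ℚ.+ ⟦ p₁ ⟧ ℚ.* (P₁ ℚ.* t)    ≡⟨ cong (λ x → x ℚ.* T ℚ.+ ⟦ p₁ ⟧ ℚ.* (P₁ ℚ.* t)) P-ratio ⟨
  ⟦ p₁ ⟧ ℚ.* P₁ ℚ.* T ℚ.+ ⟦ p₁ ⟧ ℚ.* (P₁ ℚ.* t)
    ≡⟨ solve 4 (λ K P T t → K :* P :* T :+ K :* (P :* t) := K :* (P :* (T :+ t))) refl ⟦ p₁ ⟧ P₁ T t ⟩
  ⟦ p₁ ⟧ ℚ.* (P₁ ℚ.* (T ℚ.+ t))                    ∎)
  where open +-*-Solver using (solve; _:+_; _:*_; _:=_)

-- The recurrence for the left-hand side

summand : ℕ → ℕ → ℕ → ℕ → ℕ → ℕ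
summand a b c d k = k * ((a + b) C (a + k)) * ((b + c) C (b + k)) * ((c + d) C (c + k)) * ((d + a) C (d + k))

certificate : ℕ → ℕ → ℕ → ℕ → ℕ → ℕ
certificate a b c d k =
  ((a + b) C (a + k)) * ((b + c) C (b + k)) * ((c + d) C (c + k)) * ((d + suc a) C (d + k)) * ((k + b) * (k + c) * (k + d))

p₁ : ℕ → ℕ → ℕ → ℕ
p₁ a c d = 2 * suc (a + d) * suc (a + c)

p₀ : ℕ → ℕ → ℕ → ℕ → ℕ
p₀ a b c d = 2 * suc (a + d) * suc (a + b + c + d)

ZeilbergerStep : ℕ → ℕ → ℕ → ℕ → ℕ → Set
ZeilbergerStep a b c d k =
  p₁ a c d * summand (suc a) b c d k + certificate a b c d (suc k) ≡ p₀ a b c d * summand a b c d k + certificate a b c d k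

-- p₁ and p₀ appear unfolded so that solve-∀ sees a polynomial.
certificate-coefficients : ∀ k α β γ δ →
  let a = k + α; b = k + β; c = k + γ; d = k + δ in
  2 * suc (a + d) * suc (a + c) * k * suc (b + k) * suc (c + k) * suc (d + k) * suc (a + b) * suc (d + k + α)
    + suc α * ((suc k + b) * (suc k + c) * (suc k + d)) * β * γ * δ * suc (d + k + α)
  ≡ 2 * suc (a + d) * suc (a + b + c + d) * k * (suc (a + k) * suc (b + k) * suc (c + k) * suc (d + k) * suc α)
    + suc (a + k) * suc (b + k) * suc (c + k) * suc (d + k) * ((k + b) * (k + c) * (k + d)) * suc (d + k + α)
certificate-coefficients = solve-∀

-- The six hypotheses express each binomial shifted in k or a through an unshifted one; clearing
-- their denominators s₁ … s₅ reduces the step to certificate-coefficients.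
certificate-identity : ∀ k α β γ δ {u₀ v₀ w₀ z₀ u₁ z₁ u′ v′ w′ z′} →
  let a = k + α; b = k + β; c = k + γ; d = k + δ in
  suc (a + k) * u₁ ≡ suc (a + b) * u₀ →
  suc (a + k) * u′ ≡ β * u₀ →
  suc (b + k) * v′ ≡ γ * v₀ →
  suc (c + k) * w′ ≡ δ * w₀ →
  suc α * z₁ ≡ suc (d + k + α) * z₀ →
  suc (d + k) * z′ ≡ suc α * z₁ →
  p₁ a c d * (k * u₁ * v₀ * w₀ * z₁) + u′ * v′ * w′ * z′ * ((suc k + b) * (suc k + c) * (suc k + d))
    ≡ p₀ a b c d * (k * u₀ * v₀ * w₀ * z₀) + u₀ * v₀ * w₀ * z₁ * ((k + b) * (k + c) * (k + d))
certificate-identity k α β γ δ {u₀} {v₀} {w₀} {z₀} {u₁} {z₁} {u′} {v′} {w′} {z′} u₁≡ u′≡ v′≡ w′≡ z₁≡ z′≡ =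
  *-cancelˡ-≡ _ _ (s₁ * s₂ * s₃ * s₄ * s₅) (begin
    s₁ * s₂ * s₃ * s₄ * s₅ * (P₁ * (k * u₁ * v₀ * w₀ * z₁) + u′ * v′ * w′ * z′ * Y)
      ≡⟨ regroupˡ s₁ s₂ s₃ s₄ s₅ P₁ k Y u₁ v₀ w₀ z₁ u′ v′ w′ z′ ⟩
    P₁ * k * s₂ * s₃ * s₄ * v₀ * w₀ * (s₁ * u₁) * (s₅ * z₁)
      + s₅ * Y * (s₁ * u′) * (s₂ * v′) * (s₃ * w′) * (s₄ * z′)
      ≡⟨ cong₂ _+_ (cong₂ _*_ (cong (P₁ * k * s₂ * s₃ * s₄ * v₀ * w₀ *_) u₁≡) z₁≡)
                   (cong₂ _*_ (cong₂ _*_ (cong₂ _*_ (cong (s₅ * Y *_) u′≡) v′≡) w′≡) (trans z′≡ z₁≡)) ⟩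
    P₁ * k * s₂ * s₃ * s₄ * v₀ * w₀ * (A₁ * u₀) * (A₅ * z₀)
      + s₅ * Y * (β * u₀) * (γ * v₀) * (δ * w₀) * (A₅ * z₀)
      ≡⟨ factorˡ (P₁ * k * s₂ * s₃ * s₄) (s₅ * Y) A₁ A₅ β γ δ u₀ v₀ w₀ z₀ ⟩
    (P₁ * k * s₂ * s₃ * s₄ * A₁ * A₅ + s₅ * Y * β * γ * δ * A₅) * (u₀ * v₀ * w₀ * z₀)
      ≡⟨ cong (_* (u₀ * v₀ * w₀ * z₀)) (certificate-coefficients k α β γ δ) ⟩
    (P₀ * k * (s₁ * s₂ * s₃ * s₄ * s₅) + s₁ * s₂ * s₃ * s₄ * Y₀ * A₅) * (u₀ * v₀ * w₀ * z₀)
      ≡⟨ factorʳ (P₀ * k * (s₁ * s₂ * s₃ * s₄ * s₅)) (s₁ * s₂ * s₃ * s₄ * Y₀) A₅ u₀ v₀ w₀ z₀ ⟩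
    P₀ * k * (s₁ * s₂ * s₃ * s₄ * s₅) * (u₀ * v₀ * w₀ * z₀) + s₁ * s₂ * s₃ * s₄ * Y₀ * u₀ * v₀ * w₀ * (A₅ * z₀)
      ≡⟨ cong (_+_ (P₀ * k * (s₁ * s₂ * s₃ * s₄ * s₅) * (u₀ * v₀ * w₀ * z₀)))
              (cong (s₁ * s₂ * s₃ * s₄ * Y₀ * u₀ * v₀ * w₀ *_) z₁≡) ⟨
    P₀ * k * (s₁ * s₂ * s₃ * s₄ * s₅) * (u₀ * v₀ * w₀ * z₀) + s₁ * s₂ * s₃ * s₄ * Y₀ * u₀ * v₀ * w₀ * (s₅ * z₁)
      ≡⟨ regroupʳ s₁ s₂ s₃ s₄ s₅ P₀ k Y₀ u₀ v₀ w₀ z₀ z₁ ⟩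
    s₁ * s₂ * s₃ * s₄ * s₅ * (P₀ * (k * u₀ * v₀ * w₀ * z₀) + u₀ * v₀ * w₀ * z₁ * Y₀) ∎)
  where
  a = k + α
  b = k + β
  c = k + γ
  d = k + δ
  s₁ = suc (a + k)
  s₂ = suc (b + k)
  s₃ = suc (c + k)
  s₄ = suc (d + k)
  s₅ = suc α
  A₁ = suc (a + b)
  A₅ = suc (d + k + α)
  P₁ = p₁ a c d
  P₀ = p₀ a b c d
  Y = (suc k + b) * (suc k + c) * (suc k + d)
  Y₀ = (k + b) * (k + c) * (k + d)
  regroupˡ : ∀ s₁ s₂ s₃ s₄ s₅ P k Y u₁ v₀ w₀ z₁ u′ v′ w′ z′ →
    s₁ * s₂ * s₃ * s₄ * s₅ * (P * (k * u₁ * v₀ * w₀ * z₁) + u′ * v′ * w′ * z′ * Y)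
      ≡ P * k * s₂ * s₃ * s₄ * v₀ * w₀ * (s₁ * u₁) * (s₅ * z₁) + s₅ * Y * (s₁ * u′) * (s₂ * v′) * (s₃ * w′) * (s₄ * z′)
  regroupˡ = solve-∀
  factorˡ : ∀ X X′ A₁ A₅ β γ δ u₀ v₀ w₀ z₀ →
    X * v₀ * w₀ * (A₁ * u₀) * (A₅ * z₀) + X′ * (β * u₀) * (γ * v₀) * (δ * w₀) * (A₅ * z₀)
      ≡ (X * A₁ * A₅ + X′ * β * γ * δ * A₅) * (u₀ * v₀ * w₀ * z₀)
  factorˡ = solve-∀
  factorʳ : ∀ X X′ A₅ u₀ v₀ w₀ z₀ →
    (X + X′ * A₅) * (u₀ * v₀ * w₀ * z₀) ≡ X * (u₀ * v₀ * w₀ * z₀) + X′ * u₀ * v₀ * w₀ * (A₅ * z₀)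
  factorʳ = solve-∀
  regroupʳ : ∀ s₁ s₂ s₃ s₄ s₅ P k Y₀ u₀ v₀ w₀ z₀ z₁ →
    P * k * (s₁ * s₂ * s₃ * s₄ * s₅) * (u₀ * v₀ * w₀ * z₀) + s₁ * s₂ * s₃ * s₄ * Y₀ * u₀ * v₀ * w₀ * (s₅ * z₁)
      ≡ s₁ * s₂ * s₃ * s₄ * s₅ * (P * (k * u₀ * v₀ * w₀ * z₀) + u₀ * v₀ * w₀ * z₁ * Y₀)
  regroupʳ = solve-∀

summand≡0 : ∀ a b c d k → a < k ⊎ b < k ⊎ c < k ⊎ d < k → summand a b c d k ≡ 0
summand≡0 a b c d k (inj₁ a<k)
  rewrite k>n⇒nCk≡0 (+-monoʳ-< d a<k) = *-zeroʳ (k * ((a + b) C (a + k)) * ((b + c) C (b + k)) * ((c + d) C (c + k)))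
summand≡0 a b c d k (inj₂ (inj₁ b<k))
  rewrite k>n⇒nCk≡0 (+-monoʳ-< a b<k) | *-zeroʳ k = refl
summand≡0 a b c d k (inj₂ (inj₂ (inj₁ c<k)))
  rewrite k>n⇒nCk≡0 (+-monoʳ-< b c<k) | *-zeroʳ (k * ((a + b) C (a + k))) = refl
summand≡0 a b c d k (inj₂ (inj₂ (inj₂ d<k)))
  rewrite k>n⇒nCk≡0 (+-monoʳ-< c d<k) | *-zeroʳ (k * ((a + b) C (a + k)) * ((b + c) C (b + k))) = refl

certificate≡0 : ∀ a b c d k → suc a < k ⊎ b < k ⊎ c < k ⊎ d < k → certificate a b c d k ≡ 0
certificate≡0 a b c d k (inj₁ a<k)
  rewrite k>n⇒nCk≡0 (+-monoʳ-< d a<k) | *-zeroʳ (((a + b) C (a + k)) * ((b + c) C (b + k)) * ((c + d) C (c + k))) = refl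
certificate≡0 a b c d k (inj₂ (inj₁ b<k))
  rewrite k>n⇒nCk≡0 (+-monoʳ-< a b<k) = refl
certificate≡0 a b c d k (inj₂ (inj₂ (inj₁ c<k)))
  rewrite k>n⇒nCk≡0 (+-monoʳ-< b c<k) | *-zeroʳ ((a + b) C (a + k)) = refl
certificate≡0 a b c d k (inj₂ (inj₂ (inj₂ d<k)))
  rewrite k>n⇒nCk≡0 (+-monoʳ-< c d<k) | *-zeroʳ (((a + b) C (a + k)) * ((b + c) C (b + k))) = refl

zeilberger-step-degenerate : ∀ a b c d k → b < k ⊎ c < k ⊎ d < k → ZeilbergerStep a b c d k
zeilberger-step-degenerate a b c d k small = begin
  p₁ a c d * summand (suc a) b c d k + certificate a b c d (suc k)
    ≡⟨ cong₂ (λ x y → p₁ a c d * x + y) (summand≡0 (suc a) b c d k (inj₂ small))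
         (certificate≡0 a b c d (suc k) (inj₂ (Sum.map m<n⇒m<1+n (Sum.map m<n⇒m<1+n m<n⇒m<1+n) small))) ⟩
  p₁ a c d * 0 + 0
    ≡⟨ cong (_+ 0) (trans (*-zeroʳ (p₁ a c d)) (sym (*-zeroʳ (p₀ a b c d)))) ⟩
  p₀ a b c d * 0 + 0
    ≡⟨ cong₂ (λ x y → p₀ a b c d * x + y) (summand≡0 a b c d k (inj₂ small)) (certificate≡0 a b c d k (inj₂ small)) ⟨
  p₀ a b c d * summand a b c d k + certificate a b c d k ∎

zeilberger-step-top : ∀ a b c d → ZeilbergerStep a b c d (suc a)
zeilberger-step-top a b c d = begin
  p₁ a c d * summand (suc a) b c d (suc a) + certificate a b c d (2 + a)
    ≡⟨ cong (_+_ (p₁ a c d * summand (suc a) b c d (suc a))) (certificate≡0 a b c d (2 + a) (inj₁ (n<1+n (suc a)))) ⟩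
  p₁ a c d * (suc a * u₁ * v * w * z) + 0
    ≡⟨ regroup a c d u₁ v w z ⟩
  suc (a + d) * suc (a + c) * v * w * z * (suc (a + suc a) * u₁)
    ≡⟨ cong (suc (a + d) * suc (a + c) * v * w * z *_) ([k+1]*[n+1]C[k+1]≡[n+1]*nCk (a + b) (a + suc a)) ⟩
  suc (a + d) * suc (a + c) * v * w * z * (suc (a + b) * u₀)
    ≡⟨ regroup′ a b c d u₀ v w z ⟩
  certificate a b c d (suc a)
    ≡⟨ cong (_+ certificate a b c d (suc a))
         (trans (cong (p₀ a b c d *_) (summand≡0 a b c d (suc a) (inj₁ (n<1+n a)))) (*-zeroʳ (p₀ a b c d))) ⟨
  p₀ a b c d * summand a b c d (suc a) + certificate a b c d (suc a) ∎
  where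
  u₀ = (a + b) C (a + suc a)
  u₁ = (suc a + b) C (suc a + suc a)
  v = (b + c) C (b + suc a)
  w = (c + d) C (c + suc a)
  z = (d + suc a) C (d + suc a)
  regroup : ∀ a c d u₁ v w z →
    2 * suc (a + d) * suc (a + c) * (suc a * u₁ * v * w * z) + 0 ≡ suc (a + d) * suc (a + c) * v * w * z * (suc (a + suc a) * u₁)
  regroup = solve-∀
  regroup′ : ∀ a b c d u₀ v w z →
    suc (a + d) * suc (a + c) * v * w * z * (suc (a + b) * u₀) ≡ u₀ * v * w * z * ((suc a + b) * (suc a + c) * (suc a + d))
  regroup′ = solve-∀

zeilberger-step-interior : ∀ k α β γ δ → ZeilbergerStep (k + α) (k + β) (k + γ) (k + δ) k
zeilberger-step-interior k α β γ δ = certificate-identity k α β γ δ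
  ([k+1]*[n+1]C[k+1]≡[n+1]*nCk (a + b) (a + k))
  (shift (a + k) β (sym (+-assoc a k β)) (+-suc a k))
  (shift (b + k) γ (sym (+-assoc b k γ)) (+-suc b k))
  (shift (c + k) δ (sym (+-assoc c k δ)) (+-suc c k))
  (grow (d + k) α (trans (+-suc d a) (cong suc (sym (+-assoc d k α)))) (sym (+-assoc d k α)))
  (shift (d + k) (suc α) (trans (cong (_+_ d) (sym (+-suc k α))) (sym (+-assoc d k (suc α)))) (+-suc d k))
  where
  a = k + α
  b = k + β
  c = k + γ
  d = k + δ
  shift : ∀ {n i} m r → n ≡ m + r → i ≡ suc m → suc m * (n C i) ≡ r * (n C m)
  shift m r refl refl = [k+1]*[k+r]C[k+1]≡r*[k+r]Ck m r
  grow : ∀ {n n′} m r → n ≡ suc (m + r) → n′ ≡ m + r → suc r * (n C m) ≡ suc (m + r) * (n′ C m)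
  grow m r refl refl = [r+1]*[k+r+1]Ck≡[k+r+1]*[k+r]Ck m r

zeilberger-step : ∀ a b c d k → k ≤ suc a → ZeilbergerStep a b c d k
zeilberger-step a b c d k k≤1+a with b <? k | c <? k | d <? k
... | yes b<k | _       | _       = zeilberger-step-degenerate a b c d k (inj₁ b<k)
... | no _    | yes c<k | _       = zeilberger-step-degenerate a b c d k (inj₂ (inj₁ c<k))
... | no _    | no _    | yes d<k = zeilberger-step-degenerate a b c d k (inj₂ (inj₂ d<k))
... | no b≮k  | no c≮k  | no d≮k with m≤n⇒m<n∨m≡n k≤1+a
...   | inj₂ refl = zeilberger-step-top a b c d
...   | inj₁ (s≤s k≤a)
      with m≤n⇒∃[o]m+o≡n k≤a | m≤n⇒∃[o]m+o≡n (≮⇒≥ b≮k) | m≤n⇒∃[o]m+o≡n (≮⇒≥ c≮k) | m≤n⇒∃[o]m+o≡n (≮⇒≥ d≮k)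
...     | α , refl | β , refl | γ , refl | δ , refl = zeilberger-step-interior k α β γ δ

summand-recurrence : ∀ a b c d →
  p₁ a c d * sumℕ (2 + a) (summand (suc a) b c d) ≡ p₀ a b c d * sumℕ (suc a) (summand a b c d) + certificate a b c d 0
summand-recurrence a b c d = begin
  p₁ a c d * sumℕ (2 + a) (summand (suc a) b c d)
    ≡⟨ *-distribˡ-sumℕ (p₁ a c d) (2 + a) (summand (suc a) b c d) ⟩
  sumℕ (2 + a) F₁
    ≡⟨ +-identityʳ (sumℕ (2 + a) F₁) ⟨
  sumℕ (2 + a) F₁ + 0
    ≡⟨ cong (_+_ (sumℕ (2 + a) F₁)) (certificate≡0 a b c d (2 + a) (inj₁ (n<1+n (suc a)))) ⟨
  sumℕ (2 + a) F₁ + certificate a b c d (2 + a)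
    ≡⟨ sumℕ-telescope (2 + a) F₁ F₀ (certificate a b c d) (λ k k<2+a → zeilberger-step a b c d k (≤-pred k<2+a)) ⟩
  sumℕ (suc a) F₀ + p₀ a b c d * summand a b c d (suc a) + certificate a b c d 0
    ≡⟨ cong (λ x → sumℕ (suc a) F₀ + x + certificate a b c d 0)
         (trans (cong (p₀ a b c d *_) (summand≡0 a b c d (suc a) (inj₁ (n<1+n a)))) (*-zeroʳ (p₀ a b c d))) ⟩
  sumℕ (suc a) F₀ + 0 + certificate a b c d 0
    ≡⟨ cong (_+ certificate a b c d 0)
         (trans (+-identityʳ (sumℕ (suc a) F₀)) (sym (*-distribˡ-sumℕ (p₀ a b c d) (suc a) (summand a b c d)))) ⟩
  p₀ a b c d * sumℕ (suc a) (summand a b c d) + certificate a b c d 0 ∎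
  where
  F₁ = λ k → p₁ a c d * summand (suc a) b c d k
  F₀ = λ k → p₀ a b c d * summand a b c d k

-- The recurrence for the right-hand side

prefactor : ℕ → ℕ → ℕ → ℕ → ℚ
prefactor a b c d = frac (b * Q b c * Q c d * Q (b + c + d) a) (2 * Q a c)

term : ℕ → ℕ → ℕ → ℕ → ℚ
term b c d j = frac (Q b j * Qℤ (+ c - + 1) (j + 1) * Qℤ (+ d - + 1) (j + 1)) (Q (b + c + d) (j + 1))

prefactor-recurrence : ∀ a b c d → ⟦ p₁ a c d ⟧ ℚ.* prefactor (suc a) b c d ≡ ⟦ p₀ a b c d ⟧ ℚ.* prefactor a b c d
prefactor-recurrence a b c d = begin
  ⟦ p₁ a c d ⟧ ℚ.* prefactor (suc a) b c d       ≡⟨ ⟦⟧*frac (p₁ a c d) (N * X₁) (2 * Y₁) {{2*Q-nonZero (suc a) c}} ⟩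
  frac (p₁ a c d * (N * X₁)) (2 * Y₁)
    ≡⟨ frac-cross _ (2 * Y₁) _ (2 * Y₀) {{2*Q-nonZero (suc a) c}} {{2*Q-nonZero a c}} cross ⟩
  frac (p₀ a b c d * (N * X₀)) (2 * Y₀)        ≡⟨ ⟦⟧*frac (p₀ a b c d) (N * X₀) (2 * Y₀) {{2*Q-nonZero a c}} ⟨
  ⟦ p₀ a b c d ⟧ ℚ.* prefactor a b c d           ∎
  where
  N = b * Q b c * Q c d
  X₀ = Q (b + c + d) a
  X₁ = Q (b + c + d) (suc a)
  Y₀ = Q a c
  Y₁ = Q (suc a) c
  regroup₁ : ∀ a c d N X₁ Y₀ →
    suc a * (2 * suc (a + d) * suc (a + c) * (N * X₁) * (2 * Y₀)) ≡ 2 * suc (a + d) * suc (a + c) * N * 2 * Y₀ * (suc a * X₁)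
  regroup₁ = solve-∀
  regroup₂ : ∀ a b c d N X₀ Y₀ →
    2 * suc (a + d) * suc (a + c) * N * 2 * Y₀ * (suc (b + c + d + a) * X₀)
      ≡ 2 * suc (a + d) * suc (a + b + c + d) * N * X₀ * 2 * (suc (a + c) * Y₀)
  regroup₂ = solve-∀
  regroup₃ : ∀ a b c d N X₀ Y₁ →
    2 * suc (a + d) * suc (a + b + c + d) * N * X₀ * 2 * (suc a * Y₁)
      ≡ suc a * (2 * suc (a + d) * suc (a + b + c + d) * (N * X₀) * (2 * Y₁))
  regroup₃ = solve-∀
  cross : p₁ a c d * (N * X₁) * (2 * Y₀) ≡ p₀ a b c d * (N * X₀) * (2 * Y₁)
  cross = *-cancelˡ-≡ _ _ (suc a) (begin
    suc a * (p₁ a c d * (N * X₁) * (2 * Y₀))          ≡⟨ regroup₁ a c d N X₁ Y₀ ⟩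
    2 * suc (a + d) * suc (a + c) * N * 2 * Y₀ * (suc a * X₁)
      ≡⟨ cong (2 * suc (a + d) * suc (a + c) * N * 2 * Y₀ *_) ([y+1]*Qx[y+1]≡[x+y+1]*Qxy (b + c + d) a) ⟩
    2 * suc (a + d) * suc (a + c) * N * 2 * Y₀ * (suc (b + c + d + a) * X₀)   ≡⟨ regroup₂ a b c d N X₀ Y₀ ⟩
    2 * suc (a + d) * suc (a + b + c + d) * N * X₀ * 2 * (suc (a + c) * Y₀)
      ≡⟨ cong (2 * suc (a + d) * suc (a + b + c + d) * N * X₀ * 2 *_) ([x+1]*Q[x+1]y≡[x+y+1]*Qxy a c) ⟨
    2 * suc (a + d) * suc (a + b + c + d) * N * X₀ * 2 * (suc a * Y₁)          ≡⟨ regroup₃ a b c d N X₀ Y₁ ⟩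
    suc a * (p₀ a b c d * (N * X₀) * (2 * Y₁))        ∎)

certificate-at-0 : ∀ a b c d → certificate a b c d 0 ≡ Q b a * Q b c * Q c d * Q d (suc a) * (b * c * d)
certificate-at-0 a b c d = cong (_* (b * c * d)) (cong₂ _*_ (cong₂ _*_ (cong₂ _*_
  (trans (cong ((a + b) C_) (+-identityʳ a)) (Q-comm a b))
  (cong ((b + c) C_) (+-identityʳ b)))
  (cong ((c + d) C_) (+-identityʳ c)))
  (cong ((d + suc a) C_) (+-identityʳ d)))

prefactor*term-cross : ∀ a b c d →
  p₁ a c d * (b * Q b c * Q c d * Q (b + c + d) (suc a) * (Q b a * Qℤ (+ c - + 1) (suc a) * Qℤ (+ d - + 1) (suc a)))
    ≡ certificate a b c d 0 * (2 * Q (suc a) c * Q (b + c + d) (suc a))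
prefactor*term-cross a b c d = begin
  p₁ a c d * (N * X * (Q b a * Qℤ (+ c - + 1) (suc a) * Qℤ (+ d - + 1) (suc a)))
    ≡⟨ regroup₁ a c d N X (Q b a) (Qℤ (+ c - + 1) (suc a)) (Qℤ (+ d - + 1) (suc a)) ⟩
  2 * N * X * Q b a * (suc (a + c) * Qℤ (+ c - + 1) (suc a)) * (suc (a + d) * Qℤ (+ d - + 1) (suc a))
    ≡⟨ cong₂ (λ u v → 2 * N * X * Q b a * u * v)
         (trans ([y+x+1]*Q[x-1][y+1]≡x*Qx[y+1] c a) (cong (c *_) (Q-comm c (suc a))))
         ([y+x+1]*Q[x-1][y+1]≡x*Qx[y+1] d a) ⟩
  2 * N * X * Q b a * (c * Q (suc a) c) * (d * Q d (suc a))
    ≡⟨ regroup₂ b c d (Q b c) (Q c d) X (Q b a) (Q (suc a) c) (Q d (suc a)) ⟩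
  Q b a * Q b c * Q c d * Q d (suc a) * (b * c * d) * (2 * Q (suc a) c * X)
    ≡⟨ cong (_* (2 * Q (suc a) c * X)) (certificate-at-0 a b c d) ⟨
  certificate a b c d 0 * (2 * Q (suc a) c * X) ∎
  where
  N = b * Q b c * Q c d
  X = Q (b + c + d) (suc a)
  regroup₁ : ∀ a c d N X x y z →
    2 * suc (a + d) * suc (a + c) * (N * X * (x * y * z)) ≡ 2 * N * X * x * (suc (a + c) * y) * (suc (a + d) * z)
  regroup₁ = solve-∀
  regroup₂ : ∀ b c d Qbc Qcd X Qba Y Z →
    2 * (b * Qbc * Qcd) * X * Qba * (c * Y) * (d * Z) ≡ Qba * Qbc * Qcd * Z * (b * c * d) * (2 * Y * X)
  regroup₂ = solve-∀

prefactor*term≡certificate : ∀ a b c d →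
  ⟦ p₁ a c d ⟧ ℚ.* (prefactor (suc a) b c d ℚ.* term b c d a) ≡ ⟦ certificate a b c d 0 ⟧
prefactor*term≡certificate a b c d = begin
  ⟦ p₁ a c d ⟧ ℚ.* (prefactor (suc a) b c d ℚ.* term b c d a)
    ≡⟨ cong (λ n → ⟦ p₁ a c d ⟧ ℚ.* (prefactor (suc a) b c d ℚ.*
                     frac (Q b a * Qℤ (+ c - + 1) n * Qℤ (+ d - + 1) n) (Q (b + c + d) n)))
            (+-comm a 1) ⟩
  ⟦ p₁ a c d ⟧ ℚ.* (frac N D ℚ.* frac M E)
    ≡⟨ cong (⟦ p₁ a c d ⟧ ℚ.*_) (frac-* N D M E) ⟩
  ⟦ p₁ a c d ⟧ ℚ.* frac (N * M) (D * E)
    ≡⟨ ⟦⟧*frac (p₁ a c d) (N * M) (D * E) ⟩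
  frac (p₁ a c d * (N * M)) (D * E)
    ≡⟨ frac-cross (p₁ a c d * (N * M)) (D * E) (certificate a b c d 0) 1
         (trans (*-identityʳ _) (prefactor*term-cross a b c d)) ⟩
  ⟦ certificate a b c d 0 ⟧ ∎
  where
  N = b * Q b c * Q c d * Q (b + c + d) (suc a)
  D = 2 * Q (suc a) c
  M = Q b a * Qℤ (+ c - + 1) (suc a) * Qℤ (+ d - + 1) (suc a)
  E = Q (b + c + d) (suc a)
  instance
    _ = 2*Q-nonZero (suc a) c
    _ = Q-nonZero (b + c + d) (suc a)
    _ = m*n≢0 D E

theorem2p9 : (a b c d : ℕ) →
    ⟦ sumℕ (suc a) (λ k → k * ((a + b) C (a + k)) * ((b + c) C (b + k)) * ((c + d) C (c + k)) * ((d + a) C (d + k))) ⟧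
      ≡ frac (b * Q b c * Q c d * Q (b + c + d) a) (2 * Q a c)
        ℚ.* sumℚ a (λ j → frac (Q b j * Qℤ (+ c - + 1) (j + 1) * Qℤ (+ d - + 1) (j + 1)) (Q (b + c + d) (j + 1)))
theorem2p9 zero    b c d = sym (ℚ.*-zeroʳ (prefactor 0 b c d))
theorem2p9 (suc a) b c d =
  closed-form-step {S₀ = sumℕ (suc a) (summand a b c d)} {S₁ = sumℕ (2 + a) (summand (suc a) b c d)}
    {p₀ = p₀ a b c d} {p₁ = p₁ a c d} {G = certificate a b c d 0}
    (summand-recurrence a b c d) (prefactor-recurrence a b c d) (prefactor*term≡certificate a b c d)
    (theorem2p9 a b c d)
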